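{- For every positive integer $k$, the set $\mathcal{F}_k$ of all $F_k$-overpartitions is a separable overpartition class.
   Context: Overpartitions here are partitions (non-increasing sequences of positive integers) in which the first occurrence of each distinct part value may be overlined (so among equal sizes the overlined part comes first); for a positive integer $c$ and nonnegative integer $d$, $\overline c+d=\overline{c+d}$. An $F_k$-overpartition is such an overpartition $\pi=(\pi_1,\ldots,\pi_\ell)$ with the property that whenever $\pi_i$ is overlined, $\ell-i\equiv-1\pmod k$. A set $\mathcal{P}$ of overpartitions is a separable overpartition class if there is a subset $\mathcal{B}\subset\mathcal{P}$ (the basis) such that for each $m\ge1$ the number of overpartitions in $\mathcal{B}$ with $m$ parts is finite, every overpartition in $\mathcal{P}$ with $m$ parts is uniquely of the form $(\lambda_1+\mu_1,\lambda_2+\mu_2,\ldots,\lambda_m+\mu_m)$ with $(\lambda_1,\ldots,\lambda_m)\in\mathcal{B}$ and $(\mu_1,\ldots,\mu_m)$ a non-increasing sequence of nonnegative integers, and all overpartitions of this form lie in $\mathcal{P}$. -}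

module Defs where

open import Data.Nat using (ℕ; _+_; _∸_; _≤_)
open import Data.Nat.Divisibility using (_∣_)
open import Data.Bool using (Bool; true; false)
open import Data.Product using (Σ; ∃; _×_; _,_; proj₁; proj₂)
open import Data.List using (List; []; _∷_; length; zipWith; lookup)
open import Data.List.Relation.Unary.All using (All)
open import Data.List.Relation.Unary.Linked using (Linked)
open import Data.List.Membership.Propositional using (_∈_)
open import Data.Fin using (Fin; toℕ)
open import Relation.Binary.PropositionalEquality using (_≡_)

-- A part: its size and whether it is overlined.
Part : Set
Part = ℕ × Bool

-- Consecutive condition: sizes non-increasing, and a part equal in size to
-- its predecessor is not overlined (so only the first occurrence of a size
-- may be overlined, and the overlined one comes first).
Step : Part → Part → Set
Step (a , _) (b , ob) = (b ≤ a) × (b ≡ a → ob ≡ false)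

IsOverpartition : List Part → Set
IsOverpartition π = All (λ p → 1 ≤ proj₁ p) π × Linked Step π

-- F_k-overpartition: if π_i (1-indexed) is overlined then ℓ - i ≡ -1 (mod k),
-- i.e. k ∣ ℓ - i + 1 = ℓ - j for the 0-based index j = i - 1.
IsFk : ℕ → List Part → Set
IsFk k π = IsOverpartition π
         × ((j : Fin (length π)) → proj₂ (lookup π j) ≡ true → k ∣ (length π ∸ toℕ j))

-- Componentwise sum λ + μ, keeping the overline of λᵢ (c̄ + d = overline(c+d)).
addSeq : List Part → List ℕ → List Part
addSeq = zipWith (λ p d → (proj₁ p + d , proj₂ p))

NonIncreasing : List ℕ → Set
NonIncreasing = Linked (λ a b → b ≤ a)

DecompositionIn : (List Part → Set) → ℕ → List Part → List Part → List ℕ → Set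
DecompositionIn B m π l μ =
  B l × length l ≡ m × length μ ≡ m × NonIncreasing μ × π ≡ addSeq l μ

IsSeparableClass : (List Part → Set) → Set₁
IsSeparableClass P =
  (∀ π → P π → IsOverpartition π) ×
  Σ (List Part → Set) λ B →
      (∀ l → B l → P l)
    × (∀ m → 1 ≤ m →
          ∃ (λ (L : List (List Part)) → ∀ l → B l → length l ≡ m → l ∈ L)
        × (∀ π → P π → length π ≡ m →
              Σ (List Part × List ℕ) (λ lμ → DecompositionIn B m π (proj₁ lμ) (proj₂ lμ))
            × (∀ l μ l′ μ′ → DecompositionIn B m π l μ → DecompositionIn B m π l′ μ′
                 → (l ≡ l′) × (μ ≡ μ′)))
        × (∀ l μ → B l → length l ≡ m → length μ ≡ m → NonIncreasing μ → P (addSeq l μ)))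

𝓕 : ℕ → List Part → Set
𝓕 k π = IsFk k π

-- Adding a non-increasing sequence to an overpartition keeps its overline
-- pattern, and the F_k condition only looks at that pattern. For each pattern
-- there is a least overpartition having it: its i-th part is one more than the
-- number of overlined parts after position i. Any overpartition with that
-- pattern exceeds it by a non-increasing sequence, so these least
-- overpartitions (one per admissible pattern, hence at most 2^m with m parts)
-- form a basis.
module Submission where

open import Defs
open import Data.Nat using (ℕ; _≤_; _<_; zero; suc; _+_; _∸_; z≤n; s≤s)
open import Data.Nat.Properties
open import Data.Nat.Divisibility using (_∣_)
open import Data.Bool using (Bool; true; false)
open import Data.Product using (Σ; ∃; _×_; _,_; proj₁; proj₂)
open import Data.List using (List; []; _∷_; length; lookup; map; _++_)
open import Data.List.Properties using (length-map; ∷-injectiveˡ; ∷-injectiveʳ)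
open import Data.List.Relation.Unary.All using (All; []; _∷_)
open import Data.List.Relation.Unary.Linked using (Linked; []; [-]; _∷_)
open import Data.List.Relation.Unary.Any using (here)
open import Data.List.Membership.Propositional using (_∈_)
open import Data.List.Membership.Propositional.Properties using (∈-map⁺; ∈-++⁺ˡ; ∈-++⁺ʳ)
open import Data.Fin using (Fin; toℕ; zero; suc)
open import Relation.Binary.PropositionalEquality
open import Relation.Nullary using (contradiction)
open import Function using (_∘_)

overlines : List Part → List Bool
overlines = map proj₂

countTrue : List Bool → ℕ
countTrue []           = 0
countTrue (true  ∷ bs) = suc (countTrue bs)
countTrue (false ∷ bs) = countTrue bs

allBoolLists : ℕ → List (List Bool)
allBoolLists zero    = [] ∷ []
allBoolLists (suc n) = map (true ∷_) (allBoolLists n) ++ map (false ∷_) (allBoolLists n)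

∈-allBoolLists : ∀ bs → bs ∈ allBoolLists (length bs)
∈-allBoolLists []           = here refl
∈-allBoolLists (true ∷ bs)  = ∈-++⁺ˡ (∈-map⁺ (true ∷_) (∈-allBoolLists bs))
∈-allBoolLists (false ∷ bs) =
  ∈-++⁺ʳ (map (true ∷_) (allBoolLists (length bs))) (∈-map⁺ (false ∷_) (∈-allBoolLists bs))

length-overlines : ∀ π → length (overlines π) ≡ length π
length-overlines = length-map proj₂

Step-overlined⇒< : ∀ {p b} → Step p (b , true) → b < proj₁ p
Step-overlined⇒< (b≤a , b≡a⇒false) = ≤∧≢⇒< b≤a (λ b≡a → contradiction (b≡a⇒false b≡a) λ ())

Step-+ : ∀ {a o b o′ d e} → Step (a , o) (b , o′) → e ≤ d → Step (a + d , o) (b + e , o′)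
Step-+ {a} {o} {b} {o′} {d} {e} (b≤a , b≡a⇒o′) e≤d = +-mono-≤ b≤a e≤d , λ eq → b≡a⇒o′ (b≡a eq)
  where
  b≡a : b + e ≡ a + d → b ≡ a
  b≡a eq = ≤-antisym b≤a (+-cancelʳ-≤ d a b (≤-trans (≤-reflexive (sym eq)) (+-monoʳ-≤ b e≤d)))

IsOverpartition-tail : ∀ {p ps} → IsOverpartition (p ∷ ps) → IsOverpartition ps
IsOverpartition-tail {ps = []}    (_ ∷ pos , _)       = pos , []
IsOverpartition-tail {ps = _ ∷ _} (_ ∷ pos , _ ∷ lnk) = pos , lnk

minimal : List Bool → List Part
minimal []       = []
minimal (b ∷ bs) = (suc (countTrue bs) , b) ∷ minimal bs

overlines-minimal : ∀ bs → overlines (minimal bs) ≡ bs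
overlines-minimal []       = refl
overlines-minimal (b ∷ bs) = cong (b ∷_) (overlines-minimal bs)

length-minimal : ∀ bs → length (minimal bs) ≡ length bs
length-minimal []       = refl
length-minimal (b ∷ bs) = cong suc (length-minimal bs)

minimal-isOverpartition : ∀ bs → IsOverpartition (minimal bs)
minimal-isOverpartition bs = positive bs , linked bs
  where
  positive : ∀ bs → All (λ p → 1 ≤ proj₁ p) (minimal bs)
  positive []       = []
  positive (b ∷ bs) = s≤s z≤n ∷ positive bs

  linked : ∀ bs → Linked Step (minimal bs)
  linked []                = []
  linked (b ∷ [])          = [-]
  linked (b ∷ true ∷ bs)   = (n≤1+n _ , λ eq → contradiction (sym eq) 1+n≢n) ∷ linked (true ∷ bs)
  linked (b ∷ false ∷ bs)  = (≤-refl , λ _ → refl) ∷ linked (false ∷ bs)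

minimal-head-≤ : ∀ p ps → IsOverpartition (p ∷ ps) → suc (countTrue (overlines ps)) ≤ proj₁ p
minimal-head-≤ p []                (pos ∷ _ , _) = pos
minimal-head-≤ p ((b , true) ∷ rs) (_ ∷ pos , step ∷ lnk) =
  ≤-trans (s≤s (minimal-head-≤ (b , true) rs (pos , lnk))) (Step-overlined⇒< {p} step)
minimal-head-≤ p ((b , false) ∷ rs) (_ ∷ pos , step ∷ lnk) =
  ≤-trans (minimal-head-≤ (b , false) rs (pos , lnk)) (proj₁ step)

excess : List Part → List ℕ
excess []       = []
excess (p ∷ ps) = (proj₁ p ∸ suc (countTrue (overlines ps))) ∷ excess ps

length-excess : ∀ π → length (excess π) ≡ length π
length-excess []       = refl
length-excess (p ∷ ps) = cong suc (length-excess ps)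

excess-nonIncreasing : ∀ π → IsOverpartition π → NonIncreasing (excess π)
excess-nonIncreasing []       _ = []
excess-nonIncreasing (p ∷ []) _ = [-]
excess-nonIncreasing (p ∷ (b , true) ∷ rs) op@(_ , step ∷ _) =
  ∸-monoˡ-≤ (suc (suc (countTrue (overlines rs)))) (Step-overlined⇒< {p} step)
    ∷ excess-nonIncreasing ((b , true) ∷ rs) (IsOverpartition-tail op)
excess-nonIncreasing (p ∷ (b , false) ∷ rs) op@(_ , step ∷ _) =
  ∸-monoˡ-≤ (suc (countTrue (overlines rs))) (proj₁ step)
    ∷ excess-nonIncreasing ((b , false) ∷ rs) (IsOverpartition-tail op)

minimal+excess : ∀ π → IsOverpartition π → π ≡ addSeq (minimal (overlines π)) (excess π)
minimal+excess []             _  = refl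
minimal+excess ((a , o) ∷ ps) op = cong₂ _∷_
  (cong (_, o) (sym (m+[n∸m]≡n (minimal-head-≤ (a , o) ps op))))
  (minimal+excess ps (IsOverpartition-tail op))

overlines-addSeq : ∀ l μ → length μ ≡ length l → overlines (addSeq l μ) ≡ overlines l
overlines-addSeq []      []      _  = refl
overlines-addSeq (p ∷ l) (d ∷ μ) eq = cong (proj₂ p ∷_) (overlines-addSeq l μ (suc-injective eq))

addSeq-injectiveʳ : ∀ l {μ μ′} → length μ ≡ length l → length μ′ ≡ length l →
                    addSeq l μ ≡ addSeq l μ′ → μ ≡ μ′
addSeq-injectiveʳ []      {[]}    {[]}      _  _   _  = refl
addSeq-injectiveʳ (p ∷ l) {d ∷ μ} {d′ ∷ μ′} eq eq′ sum-eq = cong₂ _∷_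
  (+-cancelˡ-≡ (proj₁ p) d d′ (cong proj₁ (∷-injectiveˡ sum-eq)))
  (addSeq-injectiveʳ l (suc-injective eq) (suc-injective eq′) (∷-injectiveʳ sum-eq))

addSeq-isOverpartition : ∀ l μ → IsOverpartition l → NonIncreasing μ → IsOverpartition (addSeq l μ)
addSeq-isOverpartition l μ (pos , lnk) μ↓ = positive l μ pos , linked l μ lnk μ↓
  where
  positive : ∀ l μ → All (λ p → 1 ≤ proj₁ p) l → All (λ p → 1 ≤ proj₁ p) (addSeq l μ)
  positive []      μ       _         = []
  positive (p ∷ l) []      _         = []
  positive (p ∷ l) (d ∷ μ) (h ∷ hs)  = ≤-trans h (m≤m+n _ d) ∷ positive l μ hs

  linked : ∀ l μ → Linked Step l → NonIncreasing μ → Linked Step (addSeq l μ)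
  linked []          _           _            _          = []
  linked (_ ∷ [])    []          _            _          = []
  linked (_ ∷ [])    (_ ∷ _)     _            _          = [-]
  linked (_ ∷ _ ∷ _) []          _            _          = []
  linked (_ ∷ _ ∷ _) (_ ∷ [])    _            _          = [-]
  linked ((a , o) ∷ q ∷ l) (d ∷ e ∷ μ) (step ∷ lnk) (e≤d ∷ μ↓) =
    Step-+ {o = o} step e≤d ∷ linked (q ∷ l) (e ∷ μ) lnk μ↓

module PatternClass
  (Cond : List Part → Set)
  (Cond-resp : ∀ {π π′} → overlines π ≡ overlines π′ → Cond π → Cond π′)
  where

  Class : List Part → Set
  Class π = IsOverpartition π × Cond π

  Basis : List Part → Set
  Basis l = Class l × l ≡ minimal (overlines l)

  basis-finite : ∀ m → ∃ λ (L : List (List Part)) → ∀ l → Basis l → length l ≡ m → l ∈ L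
  basis-finite m = map minimal (allBoolLists m) , λ l (_ , l≡min) len →
    subst (_∈ map minimal (allBoolLists m)) (sym l≡min)
      (∈-map⁺ minimal (subst (λ n → overlines l ∈ allBoolLists n)
                             (trans (length-overlines l) len) (∈-allBoolLists (overlines l))))

  minimal-basis : ∀ π → Class π → Basis (minimal (overlines π))
  minimal-basis π (_ , cond) =
    (minimal-isOverpartition bs , Cond-resp (sym (overlines-minimal bs)) cond) ,
    cong minimal (sym (overlines-minimal bs))
    where bs = overlines π

  decompose : ∀ m π → Class π → length π ≡ m →
              Σ (List Part × List ℕ) λ (l , μ) → DecompositionIn Basis m π l μ
  decompose m π cls@(op , _) len =
    (minimal (overlines π) , excess π) ,
    minimal-basis π cls ,
    trans (length-minimal (overlines π)) (trans (length-overlines π) len) ,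
    trans (length-excess π) len ,
    excess-nonIncreasing π op ,
    minimal+excess π op

  decomposition-basis : ∀ {m π l μ} → DecompositionIn Basis m π l μ → l ≡ minimal (overlines π)
  decomposition-basis {π = π} {l} {μ} (basis , len-l , len-μ , _ , π≡l+μ) = begin
    l                                 ≡⟨ proj₂ basis ⟩
    minimal (overlines l)             ≡⟨ cong minimal (overlines-addSeq l μ (trans len-μ (sym len-l))) ⟨
    minimal (overlines (addSeq l μ))  ≡⟨ cong (minimal ∘ overlines) π≡l+μ ⟨
    minimal (overlines π)             ∎
    where open ≡-Reasoning

  decomposition-unique : ∀ {m π} l μ l′ μ′ → DecompositionIn Basis m π l μ →
                         DecompositionIn Basis m π l′ μ′ → (l ≡ l′) × (μ ≡ μ′)
  decomposition-unique l μ l′ μ′ d@(_ , len-l , len-μ , _ , π≡l+μ) d′@(_ , _ , len-μ′ , _ , π≡l′+μ′) =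
    l≡l′ , addSeq-injectiveʳ l (trans len-μ (sym len-l)) (trans len-μ′ (sym len-l))
             (trans (sym π≡l+μ) (trans π≡l′+μ′ (cong (λ x → addSeq x μ′) (sym l≡l′))))
    where
    l≡l′ : l ≡ l′
    l≡l′ = trans (decomposition-basis d) (sym (decomposition-basis d′))

  closed-under-addSeq : ∀ m l μ → Basis l → length l ≡ m → length μ ≡ m → NonIncreasing μ →
                        Class (addSeq l μ)
  closed-under-addSeq m l μ ((op , cond) , _) len-l len-μ μ↓ =
    addSeq-isOverpartition l μ op μ↓ ,
    Cond-resp (sym (overlines-addSeq l μ (trans len-μ (sym len-l)))) cond

  isSeparableClass : IsSeparableClass Class
  isSeparableClass = (λ _ → proj₁) , Basis , (λ _ → proj₁) , λ m _ →
    basis-finite m ,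
    (λ π cls len → decompose m π cls len , decomposition-unique) ,
    closed-under-addSeq m

FkCondition : ℕ → List Part → Set
FkCondition k π = (j : Fin (length π)) → proj₂ (lookup π j) ≡ true → k ∣ (length π ∸ toℕ j)

FkCondition-resp : ∀ k {π π′} → overlines π ≡ overlines π′ → FkCondition k π → FkCondition k π′
FkCondition-resp k {p ∷ ps} {p′ ∷ ps′} eq cond zero overlined =
  subst (λ n → k ∣ suc n) length-ps≡ps′ (cond zero (trans (∷-injectiveˡ eq) overlined))
  where
  length-ps≡ps′ : length ps ≡ length ps′
  length-ps≡ps′ = trans (sym (length-overlines ps))
                        (trans (cong length (∷-injectiveʳ eq)) (length-overlines ps′))
FkCondition-resp k {p ∷ ps} {p′ ∷ ps′} eq cond (suc j) overlined =
  FkCondition-resp k (∷-injectiveʳ eq) (λ j → cond (suc j)) j overlined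

lemma3p10 : (k : ℕ) → 1 ≤ k → IsSeparableClass (𝓕 k)
lemma3p10 k _ = PatternClass.isSeparableClass (FkCondition k) (FkCondition-resp k)
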